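{- Let $\mathtt{Compress}_{\mathtt{SR}}$ be the LZ77 compression function with self-referencing and sliding window size $W=n$, as described in the context, and let $w,w'\in\Sigma^n$ differ in exactly one position. Let $(B_1,\dots,B_t)=\mathtt{Compress}_{\mathtt{SR}}(w)$ and $(B'_1,\dots,B'_{t'})=\mathtt{Compress}_{\mathtt{SR}}(w')$, and let $t_2$ be the number of indices $i\in[t]$ for which exactly two blocks of $(B'_1,\dots,B'_{t'})$ start inside $B_i$. Then $$t_2\le\tfrac{\sqrt[3]{9}}{2}n^{2/3}+\tfrac{\sqrt[3]{3}}{2}n^{1/3}+1.$$
   Context: For $w\in\Sigma^n$, $w[i]$ is its $i$-th character and $w[a,b]$ the substring from position $a$ to $b$. LZ77 with self-referencing and window $W$: the output on $w\in\Sigma^n$ is a sequence of blocks $B_1,\dots,B_t$, $B_i=[q_i,\ell_i,c_i]$ with integers $0\le q_i,\ell_i<n$ and $c_i\in\Sigma$; set $s_i=1+\sum_{r<i}(\ell_r+1)$ and $f_i=s_i+\ell_i$, so $B_i$ encodes $w[s_i,f_i]$. Greedily, $B_1=[0,0,w[1]]$; if the first $\mathsf{ctc}<n$ characters have been encoded, the next block uses the largest $\ell\ge 0$ (with $\mathsf{ctc}+\ell<n$) such that $w[\mathsf{ctc}+1,\mathsf{ctc}+\ell]=w[q,q+\ell-1]$ for some $q$ with $\max\{1,\mathsf{ctc}-W+1\}\le q\le\mathsf{ctc}$ (overlap $q+\ell-1>\mathsf{ctc}$ allowed); if $\ell=0$ the block is $[0,0,w[\mathsf{ctc}+1]]$,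 otherwise $[q,\ell,w[\mathsf{ctc}+\ell+1]]$; then $\mathsf{ctc}$ increases by $\ell+1$, stopping when $\mathsf{ctc}=n$. For the blocks $B'_k$ of $w'$ define $s'_k,f'_k$ analogously. Block $B'_k$ starts inside $B_i$ if $s_i\le s'_k\le f_i$. -}

module Defs where

open import Data.Nat using (ℕ; zero; suc; _+_; _*_; _∸_; _<ᵇ_; _≤ᵇ_; _⊔_)
open import Data.Bool using (Bool; true; false; if_then_else_; _∧_)
open import Data.List using (List; []; _∷_; upTo; map; filter; foldr; length)
open import Data.Bool.ListAction using (any; all)
open import Data.Maybe using (Maybe; just; nothing)
open import Data.Maybe.Properties using (≡-dec)
open import Data.Product using (_×_; _,_)
open import Relation.Binary.Definitions using (DecidableEquality)
open import Relation.Nullary.Decidable using (⌊_⌋; _×-dec_)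
open import Data.Nat using (_≤?_) renaming (_≟_ to _≟ℕ_)
open import Data.Fin using (Fin)
open import Data.Vec using (Vec; lookup)
open import Data.Product using (Σ; proj₁)
open import Relation.Binary.PropositionalEquality using (_≡_; _≢_)

-- 1-indexed character access: charAt w i = w[i] for 1 ≤ i ≤ |w|, nothing otherwise.
charAt : {A : Set} → List A → ℕ → Maybe A
charAt []       _             = nothing
charAt (x ∷ xs) zero          = nothing
charAt (x ∷ xs) (suc zero)    = just x
charAt (x ∷ xs) (suc (suc i)) = charAt xs (suc i)

module LZ77 {A : Set} (_≟_ : DecidableEquality A) (W : ℕ) (w : List A) where

  n : ℕ
  n = length w

  -- w[ctc+1, ctc+ℓ] = w[q, q+ℓ-1]  (overlap allowed)
  matches : ℕ → ℕ → ℕ → Bool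
  matches ctc q ℓ =
    all (λ j → ⌊ ≡-dec _≟_ (charAt w (suc (ctc + j))) (charAt w (q + j)) ⌋) (upTo ℓ)

  sources : ℕ → List ℕ
  sources ctc = filter (λ q → (1 ⊔ suc (ctc ∸ W)) ≤? q) (map suc (upTo ctc))

  valid : ℕ → ℕ → Bool
  valid ctc ℓ = ((ctc + ℓ) <ᵇ n) ∧ any (λ q → matches ctc q ℓ) (sources ctc)

  bestLen : ℕ → ℕ
  bestLen ctc = foldr (λ ℓ m → if valid ctc ℓ then ℓ ⊔ m else m) 0 (upTo n)

  -- the (smallest) q realising bestLen; 0 when bestLen = 0
  bestSrc : ℕ → ℕ
  bestSrc ctc with bestLen ctc
  ... | zero  = 0
  ... | suc ℓ = foldr (λ q r → if matches ctc q (suc ℓ) then q else r) 0 (sources ctc)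

  -- greedy parse, as a list of (q_i , ℓ_i) (the literal character c_i is
  -- w[f_i], determined by the positions and irrelevant here); fuel n suffices
  -- since every block advances ctc by ℓ+1 ≥ 1.
  parseFuel : ℕ → ℕ → List (ℕ × ℕ)
  parseFuel zero       ctc = []
  parseFuel (suc fuel) ctc =
    if ctc <ᵇ n
    then (bestSrc ctc , bestLen ctc) ∷ parseFuel fuel (ctc + suc (bestLen ctc))
    else []

  compress : List (ℕ × ℕ)
  compress = parseFuel n 0

compressSR : {A : Set} → DecidableEquality A → List A → List (ℕ × ℕ)
compressSR _≟_ w = LZ77.compress _≟_ (length w) w

intervalsFrom : ℕ → List (ℕ × ℕ) → List (ℕ × ℕ)
intervalsFrom s []              = []
intervalsFrom s ((q , ℓ) ∷ bs) = (s , s + ℓ) ∷ intervalsFrom (s + suc ℓ) bs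

intervals : List (ℕ × ℕ) → List (ℕ × ℕ)
intervals = intervalsFrom 1

starts : List (ℕ × ℕ) → List ℕ
starts bs = map proj₁ (intervals bs)

startsInside : List (ℕ × ℕ) → ℕ × ℕ → ℕ
startsInside bs' (s , f) = length (filter (λ s' → s ≤? s' ×-dec s' ≤? f) (starts bs'))

t₂ : List (ℕ × ℕ) → List (ℕ × ℕ) → ℕ
t₂ bs bs' = length (filter (λ I → startsInside bs' I ≟ℕ 2) (intervals bs))

DifferInExactlyOne : {A : Set} {n : ℕ} → Vec A n → Vec A n → Set
DifferInExactlyOne {n = n} w w' =
  Σ (Fin n) λ i → (lookup w i ≢ lookup w' i) × (∀ j → j ≢ i → lookup w j ≡ lookup w' j)

module Submission where

-- Let J be the mismatch position. If two blocks of w' start inside a block B = [c+1, c+1+ℓ] of w,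
-- the first of them lies entirely inside B, before its last character. When B avoids J, the
-- source window [q, q+ℓ-1] of B must contain J: otherwise that inner block of w' could copy from
-- the corresponding place of the window, through w, one character further than the greedy parse
-- lets it. For the same reason two such blocks of w cannot have the same length ℓ and the same
-- source q, so their tags (ℓ, J - q) are distinct pairs with J - q < ℓ. At most k tags have first
-- component k while the numbers ℓ + 1 add up to at most n, which bounds the number of tags by
-- x²/2 + x/2 for x³ = 3n; at most one further block of w contains J.

open import Defs
open import Data.Bool using (Bool; T; true; false; if_then_else_)
open import Data.Bool.ListAction using (any)
open import Data.Bool.Properties using (T-∧; T-≡)
open import Data.Empty using (⊥; ⊥-elim)
open import Data.Fin using (Fin; toℕ) renaming (zero to fzero; suc to fsuc)
open import Data.Fin.Properties using () renaming (suc-injective to fsuc-injective)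
open import Data.List using (List; []; _∷_; map; filter; length; upTo; foldr)
open import Data.List.Membership.Propositional using (_∈_; lose)
open import Data.List.Membership.Propositional.Properties using (∈-upTo⁺; ∈-upTo⁻; ∈-map⁺; ∈-map⁻; ∈-filter⁺; ∈-filter⁻)
open import Data.List.Properties using (filter-all; filter-accept; filter-reject; filter-none; length-map; length-upTo; map-∘)
open import Data.List.Relation.Unary.All as All using (All; []; _∷_)
open import Data.List.Relation.Unary.All.Properties using (all⁺; all⁻)
import Data.List.Relation.Unary.All.Properties as All
open import Data.List.Relation.Unary.AllPairs as AllPairs using (AllPairs; []; _∷_)
import Data.List.Relation.Unary.AllPairs.Properties as AllPairs
open import Data.List.Relation.Unary.Any using (Any; here; there)
open import Data.List.Relation.Unary.Any.Properties using (any⁺)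
open import Data.List.Relation.Unary.Unique.Propositional using (Unique)
import Data.List.Relation.Unary.Unique.Propositional.Properties as Unique
open import Data.Maybe using (just)
open import Data.Nat using (ℕ; zero; suc; pred; s≤s⁻¹; NonZero; >-nonZero; _+_; _*_; _∸_; _^_; _⊔_; _<ᵇ_; _≤_; _<_; z≤n; s≤s; _≤?_; _<?_; _≟_)
open import Data.Nat.DivMod using (_/_; m≡m%n+[m/n]*n; m/n*n≤m; m%n≤n)
open import Data.Nat.ListAction using (sum)
open import Data.Nat.Properties
open import Data.Nat.Tactic.RingSolver using (solve-∀)
open import Data.Product using (_×_; _,_; proj₁; proj₂; ∃)
open import Data.Product.Properties using () renaming (≡-dec to ×-≡-dec)
open import Data.Sum using (_⊎_; inj₁; inj₂; [_,_]′)
open import Data.Vec using (Vec; _∷_; toList; lookup)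
open import Data.Vec.Properties using (length-toList; tabulate∘lookup; tabulate-cong)
open import Function using (_∘_; id; Equivalence)
open import Level using (0ℓ)
open import Relation.Binary.Definitions using (DecidableEquality; tri<; tri≈; tri>)
open import Relation.Binary.PropositionalEquality using (_≡_; _≢_; refl; sym; trans; cong; cong₂; subst; module ≡-Reasoning)
open import Relation.Nullary using (¬_; Dec; yes; no; contradiction)
open import Relation.Nullary.Decidable using (¬?; _×-dec_; toWitness; fromWitness)
open import Relation.Unary using (Pred; Decidable)

module _ {A : Set} {P : Pred A 0ℓ} (P? : Decidable P) where

  length≤1+length-filter-¬ : {xs : List A} → AllPairs (λ x y → ¬ (P x × P y)) xs →
                             length xs ≤ suc (length (filter (¬? ∘ P?) xs))
  length≤1+length-filter-¬ {[]}     []       = z≤n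
  length≤1+length-filter-¬ {x ∷ xs} (h ∷ hs) with P? x
  ... | yes px = s≤s (≤-reflexive (cong length (sym (filter-all (¬? ∘ P?) (All.map (λ h py → h (px , py)) h)))))
  ... | no _   = s≤s (length≤1+length-filter-¬ hs)

  ∃-of-length-filter : (xs : List A) → 0 < length (filter P? xs) → ∃ λ x → x ∈ xs × P x
  ∃-of-length-filter (x ∷ xs) 0<len with P? x
  ... | yes px = x , here refl , px
  ... | no _   = let y , y∈xs , py = ∃-of-length-filter xs 0<len in y , there y∈xs , py

pigeonhole : {A : Set} → DecidableEquality A → {xs ys : List A} →
             Unique xs → (∀ {x} → x ∈ xs → x ∈ ys) → length xs ≤ length ys
pigeonhole _≟ᴬ_ {[]}    {ys}     _ _   = z≤n
pigeonhole _≟ᴬ_ {x ∷ _} {[]}     _ xs⊆ = contradiction (xs⊆ (here refl)) λ ()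
pigeonhole _≟ᴬ_ {xs}    {y ∷ ys} u xs⊆ =
  ≤-trans (length≤1+length-filter-¬ (_≟ᴬ y) (AllPairs.map (λ x≢x' (x≡y , x'≡y) → x≢x' (trans x≡y (sym x'≡y))) u))
          (s≤s (pigeonhole _≟ᴬ_ (Unique.filter⁺ (¬? ∘ (_≟ᴬ y)) u) rest⊆))
  where
    rest⊆ : ∀ {x} → x ∈ filter (¬? ∘ (_≟ᴬ y)) xs → x ∈ ys
    rest⊆ x∈ with ∈-filter⁻ (¬? ∘ (_≟ᴬ y)) {xs = xs} x∈
    ... | x∈xs , x≢y with xs⊆ x∈xs
    ...   | here x≡y = contradiction x≡y x≢y
    ...   | there x∈ys = x∈ys

AllPairs-mapWithAll : {A : Set} {P : A → Set} {R S : A → A → Set} {xs : List A} → All P xs → AllPairs R xs →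
                      (∀ {x y} → P x → P y → R x y → S x y) → AllPairs S xs
AllPairs-mapWithAll []         []         _ = []
AllPairs-mapWithAll (px ∷ pxs) (rx ∷ rxs) f = All.zipWith (λ (py , rxy) → f px py rxy) (pxs , rx) ∷ AllPairs-mapWithAll pxs rxs f

module _ {A : Set} (f : A → ℕ) where

  sum-map-+ : (g : A → ℕ) (xs : List A) → sum (map (λ x → f x + g x) xs) ≡ sum (map f xs) + sum (map g xs)
  sum-map-+ g []       = refl
  sum-map-+ g (x ∷ xs) = trans (cong (f x + g x +_) (sum-map-+ g xs)) (interchange (f x) (g x) _ _)
    where
      interchange : ∀ a b c d → (a + b) + (c + d) ≡ (a + c) + (b + d)
      interchange = solve-∀

  sum-map-≡0 : {xs : List A} → All (λ x → f x ≡ 0) xs → sum (map f xs) ≡ 0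
  sum-map-≡0 []               = refl
  sum-map-≡0 (fx≡0 ∷ fxs≡0) = cong₂ _+_ fx≡0 (sum-map-≡0 fxs≡0)

  *-length≤sum-map : ∀ {k} → (∀ x → k ≤ f x) → (xs : List A) → k * length xs ≤ sum (map f xs)
  *-length≤sum-map {k} k≤f []       = ≤-reflexive (*-zeroʳ k)
  *-length≤sum-map {k} k≤f (x ∷ xs) = ≤-trans (≤-reflexive (*-suc k (length xs))) (+-mono-≤ (k≤f x) (*-length≤sum-map k≤f xs))

  length-filter-≤-suc : ∀ c (xs : List A) →
    length (filter ((_≤? suc c) ∘ f) xs) ≡ length (filter ((_≤? c) ∘ f) xs) + length (filter ((_≟ suc c) ∘ f) xs)
  length-filter-≤-suc c []       = refl
  length-filter-≤-suc c (x ∷ xs) with <-cmp (f x) (suc c)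
  ... | tri< fx<1+c fx≢ _
    rewrite filter-accept ((_≤? suc c) ∘ f) {x} {xs} (<⇒≤ fx<1+c)
          | filter-accept ((_≤? c) ∘ f) {x} {xs} (s≤s⁻¹ fx<1+c)
          | filter-reject ((_≟ suc c) ∘ f) {x} {xs} fx≢
    = cong suc (length-filter-≤-suc c xs)
  ... | tri≈ _ fx≡ _
    rewrite filter-accept ((_≤? suc c) ∘ f) {x} {xs} (≤-reflexive fx≡)
          | filter-reject ((_≤? c) ∘ f) {x} {xs} (λ fx≤c → n≮n c (≤-trans (≤-reflexive (sym fx≡)) fx≤c))
          | filter-accept ((_≟ suc c) ∘ f) {x} {xs} fx≡
    = trans (cong suc (length-filter-≤-suc c xs)) (sym (+-suc _ _))
  ... | tri> _ fx≢ fx>1+c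
    rewrite filter-reject ((_≤? suc c) ∘ f) {x} {xs} (<⇒≱ fx>1+c)
          | filter-reject ((_≤? c) ∘ f) {x} {xs} (<⇒≱ (<-trans (n<1+n c) fx>1+c))
          | filter-reject ((_≟ suc c) ∘ f) {x} {xs} fx≢
    = length-filter-≤-suc c xs

  sum-map-suc-∸ : ∀ m (xs : List A) →
    sum (map (λ x → suc m ∸ f x) xs) ≡ sum (map (λ x → m ∸ f x) xs) + length (filter ((_≤? m) ∘ f) xs)
  sum-map-suc-∸ m []       = refl
  sum-map-suc-∸ m (x ∷ xs) with ≤-<-connex (f x) m
  ... | inj₁ fx≤m rewrite filter-accept ((_≤? m) ∘ f) {x} {xs} fx≤m =
    begin
      suc m ∸ f x + sum (map (λ x → suc m ∸ f x) xs)           ≡⟨ cong₂ _+_ (+-∸-assoc 1 fx≤m) (sum-map-suc-∸ m xs) ⟩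
      suc (m ∸ f x) + (sum (map (λ x → m ∸ f x) xs) + count)   ≡⟨ shuffle (m ∸ f x) _ count ⟩
      m ∸ f x + sum (map (λ x → m ∸ f x) xs) + suc count        ∎
    where
      open ≡-Reasoning
      count = length (filter ((_≤? m) ∘ f) xs)
      shuffle : ∀ a b c → suc a + (b + c) ≡ (a + b) + suc c
      shuffle = solve-∀
  ... | inj₂ m<fx rewrite filter-reject ((_≤? m) ∘ f) {x} {xs} (<⇒≱ m<fx)
                        | m≤n⇒m∸n≡0 m<fx | m≤n⇒m∸n≡0 (<⇒≤ m<fx) = sum-map-suc-∸ m xs

-- Distinct pairs (ℓ , o) with o < ℓ

module DistinctPairs {X : List (ℕ × ℕ)} (distinct : Unique X) (snd<fst : All (λ t → proj₂ t < proj₁ t) X) where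

  #fst≡ #fst≤ : ℕ → ℕ
  #fst≡ k = length (filter ((_≟ k) ∘ proj₁) X)
  #fst≤ c = length (filter ((_≤? c) ∘ proj₁) X)

  deficit : ℕ → ℕ
  deficit m = sum (map (λ t → suc m ∸ proj₁ t) X)

  #fst≡≤ : ∀ k → #fst≡ k ≤ k
  #fst≡≤ k = begin
    #fst≡ k                      ≤⟨ pigeonhole (×-≡-dec _≟_ _≟_) (Unique.filter⁺ ((_≟ k) ∘ proj₁) distinct) ⊆pairs ⟩
    length (map (k ,_) (upTo k)) ≡⟨ trans (length-map (k ,_) (upTo k)) (length-upTo k) ⟩
    k                            ∎
    where
      open ≤-Reasoning
      ⊆pairs : ∀ {t} → t ∈ filter ((_≟ k) ∘ proj₁) X → t ∈ map (k ,_) (upTo k)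
      ⊆pairs {ℓ , o} t∈ with ∈-filter⁻ ((_≟ k) ∘ proj₁) {xs = X} t∈
      ... | t∈X , refl = ∈-map⁺ (ℓ ,_) (∈-upTo⁺ (All.lookup snd<fst t∈X))

  #fst≤≤ : ∀ c → 2 * #fst≤ c ≤ c * suc c
  #fst≤≤ zero    = ≤-reflexive (cong (λ ys → 2 * length ys)
    (filter-none ((_≤? 0) ∘ proj₁) (All.map (λ o<ℓ ℓ≤0 → n≮0 (≤-trans o<ℓ ℓ≤0)) snd<fst)))
  #fst≤≤ (suc c) = begin
    2 * #fst≤ (suc c)                 ≡⟨ cong (2 *_) (length-filter-≤-suc proj₁ c X) ⟩
    2 * (#fst≤ c + #fst≡ (suc c))     ≡⟨ *-distribˡ-+ 2 (#fst≤ c) (#fst≡ (suc c)) ⟩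
    2 * #fst≤ c + 2 * #fst≡ (suc c)   ≤⟨ +-mono-≤ (#fst≤≤ c) (*-monoʳ-≤ 2 (#fst≡≤ (suc c))) ⟩
    c * suc c + 2 * suc c             ≡⟨ step c ⟩
    suc c * suc (suc c)               ∎
    where
      open ≤-Reasoning
      step : ∀ c → c * suc c + 2 * suc c ≡ suc c * suc (suc c)
      step = solve-∀

  deficit≤ : ∀ m → 6 * deficit m ≤ m * suc m * (2 + m)
  deficit≤ zero    = ≤-reflexive (cong (6 *_)
    (sum-map-≡0 (λ t → 1 ∸ proj₁ t) (All.map (m≤n⇒m∸n≡0 ∘ ≤-trans (s≤s z≤n)) snd<fst)))
  deficit≤ (suc m) = begin
    6 * deficit (suc m)                              ≡⟨ cong (6 *_) (sum-map-suc-∸ proj₁ (suc m) X) ⟩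
    6 * (deficit m + #fst≤ (suc m))                  ≡⟨ split (deficit m) (#fst≤ (suc m)) ⟩
    6 * deficit m + 3 * (2 * #fst≤ (suc m))          ≤⟨ +-mono-≤ (deficit≤ m) (*-monoʳ-≤ 3 (#fst≤≤ (suc m))) ⟩
    m * suc m * (2 + m) + 3 * (suc m * suc (suc m))  ≡⟨ step m ⟩
    suc m * suc (suc m) * (2 + suc m)                ∎
    where
      open ≤-Reasoning
      split : ∀ a b → 6 * (a + b) ≡ 6 * a + 3 * (2 * b)
      split = solve-∀
      step : ∀ m → m * suc m * (2 + m) + 3 * (suc m * suc (suc m)) ≡ suc m * suc (suc m) * (2 + suc m)
      step = solve-∀

  weighted-length≤ : ∀ m → 6 * ((2 + m) * length X) ≤ 6 * sum (map (suc ∘ proj₁) X) + m * suc m * (2 + m)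
  weighted-length≤ m = begin
    6 * ((2 + m) * length X)                                 ≤⟨ *-monoʳ-≤ 6 (*-length≤sum-map _ 2+m≤ X) ⟩
    6 * sum (map (λ t → suc (proj₁ t) + (suc m ∸ proj₁ t)) X)
      ≡⟨ cong (6 *_) (sum-map-+ (suc ∘ proj₁) (λ t → suc m ∸ proj₁ t) X) ⟩
    6 * (weight + deficit m)                                 ≡⟨ *-distribˡ-+ 6 weight (deficit m) ⟩
    6 * weight + 6 * deficit m                               ≤⟨ +-monoʳ-≤ (6 * weight) (deficit≤ m) ⟩
    6 * weight + m * suc m * (2 + m)                         ∎
    where
      open ≤-Reasoning
      weight = sum (map (suc ∘ proj₁) X)
      2+m≤ : ∀ t → 2 + m ≤ suc (proj₁ t) + (suc m ∸ proj₁ t)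
      2+m≤ t = s≤s (m≤n+m∸n (suc m) (proj₁ t))

cubic-bound : ∀ n T p r M → .{{NonZero r}} → M * r ≤ p → p ≤ suc M * r →
              6 * ((2 + M) * T) ≤ 6 * n + M * suc M * (2 + M) → 3 * n * r ^ 3 ≤ p ^ 3 →
              2 * T * r ^ 2 ≤ p ^ 2 + p * r
cubic-bound n T p r M Mr≤p p≤[1+M]r 6[2+M]T≤ 3nr³≤p³ = *-cancelˡ-≤ (3 * A) (begin
    3 * A * (2 * T * r ^ 2)                             ≡⟨ e₁ M r T ⟩
    r ^ 3 * (6 * ((2 + M) * T))                         ≤⟨ *-monoʳ-≤ (r ^ 3) 6[2+M]T≤ ⟩
    r ^ 3 * (6 * n + M * suc M * (2 + M))               ≡⟨ e₂ M r n ⟩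
    2 * (3 * n * r ^ 3) + A * (M * r * (M * r + r))
      ≤⟨ +-mono-≤ (*-monoʳ-≤ 2 3nr³≤p³) (*-monoʳ-≤ A (*-mono-≤ Mr≤p (+-monoˡ-≤ r Mr≤p))) ⟩
    2 * (p * p ^ 2) + A * (p * (p + r))                 ≤⟨ +-monoˡ-≤ (A * (p * (p + r))) (*-monoʳ-≤ 2 (*-monoˡ-≤ (p ^ 2) p≤A)) ⟩
    2 * (A * p ^ 2) + A * (p * (p + r))
      ≤⟨ +-monoˡ-≤ (A * (p * (p + r))) (*-monoʳ-≤ 2 (*-monoʳ-≤ A (m≤m+n (p ^ 2) (p * r)))) ⟩
    2 * (A * (p ^ 2 + p * r)) + A * (p * (p + r))       ≡⟨ e₃ A p r ⟩
    3 * A * (p ^ 2 + p * r)                             ∎)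
  where
    open ≤-Reasoning
    A = (2 + M) * r
    instance
      3A≢0 : NonZero (3 * A)
      3A≢0 = m*n≢0 3 A {{_}} {{m*n≢0 (2 + M) r}}
    p≤A : p ≤ A
    p≤A = ≤-trans p≤[1+M]r (*-monoˡ-≤ r (n≤1+n (suc M)))
    e₁ : ∀ M r T → 3 * ((2 + M) * r) * (2 * T * (r * (r * 1))) ≡ r * (r * (r * 1)) * (6 * ((2 + M) * T))
    e₁ = solve-∀
    e₂ : ∀ M r n → r * (r * (r * 1)) * (6 * n + M * suc M * (2 + M))
                   ≡ 2 * (3 * n * (r * (r * (r * 1)))) + (2 + M) * r * (M * r * (M * r + r))
    e₂ = solve-∀
    e₃ : ∀ A p r → 2 * (A * (p * (p * 1) + p * r)) + A * (p * (p + r)) ≡ 3 * A * (p * (p * 1) + p * r)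
    e₃ = solve-∀

module _ {X : List (ℕ × ℕ)} (distinct : Unique X) (snd<fst : All (λ t → proj₂ t < proj₁ t) X) where
  open DistinctPairs distinct snd<fst

  distinct-pairs-length≤ : ∀ n p r .{{_ : NonZero r}} → sum (map (suc ∘ proj₁) X) ≤ n → 3 * n * r ^ 3 ≤ p ^ 3 →
                          2 * length X * r ^ 2 ≤ p ^ 2 + p * r
  distinct-pairs-length≤ n p r weight≤n =
    cubic-bound n (length X) p r M (m/n*n≤m p r) p≤[1+M]r
      (≤-trans (weighted-length≤ M) (+-monoˡ-≤ (M * suc M * (2 + M)) (*-monoʳ-≤ 6 weight≤n)))
    where
      M = p / r
      p≤[1+M]r : p ≤ suc M * r
      p≤[1+M]r = ≤-trans (≤-reflexive (m≡m%n+[m/n]*n p r)) (+-monoˡ-≤ (M * r) (m%n≤n p r))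

-- Consecutive intervals

Precedes : ℕ × ℕ → ℕ × ℕ → Set
Precedes I I' = proj₂ I < proj₁ I'

between? : ∀ s f → Decidable (λ x → s ≤ x × x ≤ f)
between? s f x = s ≤? x ×-dec x ≤? f

width : ℕ × ℕ → ℕ
width I = suc (proj₂ I ∸ proj₁ I)

intervalsFrom-start≥ : ∀ a bs → All (λ I → a ≤ proj₁ I) (intervalsFrom a bs)
intervalsFrom-start≥ a []             = []
intervalsFrom-start≥ a ((_ , ℓ) ∷ bs) = ≤-refl ∷ All.map (≤-trans (m≤m+n a (suc ℓ))) (intervalsFrom-start≥ (a + suc ℓ) bs)

intervalsFrom-sorted : ∀ a bs → AllPairs Precedes (intervalsFrom a bs)
intervalsFrom-sorted a []             = []
intervalsFrom-sorted a ((_ , ℓ) ∷ bs) =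
  All.map (≤-trans (≤-reflexive (sym (+-suc a ℓ)))) (intervalsFrom-start≥ (a + suc ℓ) bs) ∷ intervalsFrom-sorted (a + suc ℓ) bs

inner-of-two-starts : ∀ a bs {s f} →
  2 ≤ length (filter (between? s f) (map proj₁ (intervalsFrom a bs))) →
  Any (λ I → s ≤ proj₁ I × proj₂ I < f) (intervalsFrom a bs)
inner-of-two-starts a ((_ , ℓ) ∷ bs) {s} {f} two with between? s f a
... | no a∉ = there (inner-of-two-starts (a + suc ℓ) bs (subst (λ ys → 2 ≤ length ys) (filter-reject (between? s f) a∉) two))
... | yes a∈@(s≤a , _)
  with ∃-of-length-filter (between? s f) _ (s≤s⁻¹ (subst (λ ys → 2 ≤ length ys) (filter-accept (between? s f) a∈) two))
...   | s' , s'∈ , (_ , s'≤f) =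
  here (s≤a , ≤-trans (≤-reflexive (sym (+-suc a ℓ)))
                      (≤-trans (All.lookup (All.map⁺ (intervalsFrom-start≥ (a + suc ℓ) bs)) s'∈) s'≤f))

sum-width≤ : ∀ {a b} Is → AllPairs Precedes Is → All (λ I → a ≤ proj₁ I × proj₁ I ≤ proj₂ I × proj₂ I < b) Is →
             a ≤ b → a + sum (map width Is) ≤ b
sum-width≤ {a} []             _        _                           a≤b = ≤-trans (≤-reflexive (+-identityʳ a)) a≤b
sum-width≤ {a} {b} ((s , f) ∷ Is) (s,f≺ ∷ sorted) ((a≤s , s≤f , f<b) ∷ bounds) _ = begin
  a + (width (s , f) + sum (map width Is)) ≡⟨ sym (+-assoc a (width (s , f)) _) ⟩
  a + width (s , f) + sum (map width Is)   ≤⟨ +-monoˡ-≤ _ (+-monoˡ-≤ (width (s , f)) a≤s) ⟩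
  s + suc (f ∸ s) + sum (map width Is)
    ≡⟨ cong (_+ sum (map width Is)) (trans (+-suc s (f ∸ s)) (cong suc (m+[n∸m]≡n s≤f))) ⟩
  suc f + sum (map width Is)
    ≤⟨ sum-width≤ Is sorted (All.zipWith (λ (f<s' , _ , rest) → f<s' , rest) (s,f≺ , bounds)) f<b ⟩
  b                                        ∎
  where open ≤-Reasoning

-- The greedy parse

maxWhere : (ℕ → Bool) → List ℕ → ℕ
maxWhere v = foldr (λ ℓ m → if v ℓ then ℓ ⊔ m else m) 0

module _ (v : ℕ → Bool) where

  maxWhere-upper : ∀ {x xs} → x ∈ xs → T (v x) → x ≤ maxWhere v xs
  maxWhere-upper {x} {.x ∷ ys} (here refl) vx with v x
  ... | true = m≤m⊔n x (maxWhere v ys)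
  maxWhere-upper {x} {y ∷ ys} (there x∈) vx with v y
  ... | true  = ≤-trans (maxWhere-upper x∈ vx) (m≤n⊔m y (maxWhere v ys))
  ... | false = maxWhere-upper x∈ vx

  maxWhere-zero-or-valid : ∀ xs → maxWhere v xs ≡ 0 ⊎ T (v (maxWhere v xs))
  maxWhere-zero-or-valid []       = inj₁ refl
  maxWhere-zero-or-valid (y ∷ ys) with v y in vy | ⊔-sel y (maxWhere v ys)
  ... | false | _                  = maxWhere-zero-or-valid ys
  ... | true  | inj₁ y⊔m≡y rewrite y⊔m≡y = inj₂ (Equivalence.from T-≡ vy)
  ... | true  | inj₂ y⊔m≡m rewrite y⊔m≡m = maxWhere-zero-or-valid ys

firstWhere : (ℕ → Bool) → List ℕ → ℕ
firstWhere v = foldr (λ q r → if v q then q else r) 0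

firstWhere-valid : (v : ℕ → Bool) (xs : List ℕ) → T (any v xs) → firstWhere v xs ∈ xs × T (v (firstWhere v xs))
firstWhere-valid v (y ∷ ys) h with v y in vy
... | true  = here refl , Equivalence.from T-≡ vy
... | false = let q∈ , vq = firstWhere-valid v ys h in there q∈ , vq

module Greedy {A : Set} (_≟ᴬ_ : DecidableEquality A) (w : List A) where

  open LZ77 _≟ᴬ_ (length w) w public

  Match : ℕ → ℕ → ℕ → Set
  Match ctc q ℓ = ∀ e → e < ℓ → charAt w (suc (ctc + e)) ≡ charAt w (q + e)

  Source : ℕ → ℕ → ℕ → Set
  Source ctc q ℓ = 1 ≤ q × q ≤ ctc × Match ctc q ℓ

  private
    Match⇒matches : ∀ {ctc q ℓ} → Match ctc q ℓ → T (matches ctc q ℓ)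
    Match⇒matches m = all⁻ _ (All.tabulate λ e∈ → fromWitness (m _ (∈-upTo⁻ e∈)))

    matches⇒Match : ∀ {ctc q ℓ} → T (matches ctc q ℓ) → Match ctc q ℓ
    matches⇒Match {ℓ = ℓ} t e e<ℓ = toWitness (All.lookup (all⁺ _ (upTo ℓ) t) (∈-upTo⁺ e<ℓ))

    ∈-sources : ∀ {ctc q} → ctc ≤ n → 1 ≤ q → q ≤ ctc → q ∈ sources ctc
    ∈-sources {ctc} {suc q} ctc≤n _ q<ctc =
      ∈-filter⁺ (λ q → (1 ⊔ suc (ctc ∸ n)) ≤? q) (∈-map⁺ suc (∈-upTo⁺ q<ctc))
        (subst (λ k → 1 ⊔ suc k ≤ suc q) (sym (m≤n⇒m∸n≡0 ctc≤n)) (s≤s z≤n))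

    sources-bounds : ∀ {ctc q} → q ∈ sources ctc → 1 ≤ q × q ≤ ctc
    sources-bounds {ctc} q∈
      with ∈-map⁻ suc (proj₁ (∈-filter⁻ (λ q → (1 ⊔ suc (ctc ∸ n)) ≤? q) {xs = map suc (upTo ctc)} q∈))
    ... | _ , q<ctc , refl = s≤s z≤n , ∈-upTo⁻ q<ctc

    valid⇒bound : ∀ {ctc ℓ} → T (valid ctc ℓ) → ctc + ℓ < n
    valid⇒bound {ctc} {ℓ} t = <ᵇ⇒< (ctc + ℓ) n (proj₁ (Equivalence.to T-∧ t))

  bestLen-maximal : ∀ {ctc q ℓ} → ctc + ℓ < n → Source ctc q ℓ → ℓ ≤ bestLen ctc
  bestLen-maximal {ctc} {ℓ = ℓ} ctc+ℓ<n (1≤q , q≤ctc , m) =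
    maxWhere-upper (valid ctc) (∈-upTo⁺ (≤-<-trans (m≤n+m ℓ ctc) ctc+ℓ<n)) valid-ℓ
    where
      valid-ℓ : T (valid ctc ℓ)
      valid-ℓ = Equivalence.from T-∧
        (<⇒<ᵇ ctc+ℓ<n , any⁺ (λ q → matches ctc q ℓ)
          (lose (∈-sources (≤-trans (m≤m+n ctc ℓ) (<⇒≤ ctc+ℓ<n)) 1≤q q≤ctc) (Match⇒matches m)))

  bestLen-bounded : ∀ {ctc} → ctc < n → ctc + bestLen ctc < n
  bestLen-bounded {ctc} ctc<n with maxWhere-zero-or-valid (valid ctc) (upTo n)
  ... | inj₁ ℓ≡0 rewrite ℓ≡0 | +-identityʳ ctc = ctc<n
  ... | inj₂ valid-ℓ = valid⇒bound {ctc} valid-ℓ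

  bestSrc-source : ∀ {ctc} → 0 < bestLen ctc → Source ctc (bestSrc ctc) (bestLen ctc)
  bestSrc-source {ctc} 0<ℓ with maxWhere-zero-or-valid (valid ctc) (upTo n)
  ... | inj₁ ℓ≡0 = contradiction ℓ≡0 (>⇒≢ 0<ℓ)
  ... | inj₂ valid-ℓ with bestLen ctc
  ... | suc ℓ with firstWhere-valid (λ q → matches ctc q (suc ℓ)) (sources ctc) (proj₂ (Equivalence.to T-∧ valid-ℓ))
  ... | q∈ , matches-q = let 1≤q , q≤ctc = sources-bounds q∈ in 1≤q , q≤ctc , matches⇒Match matches-q

  blockAt : ℕ → ℕ × ℕ
  blockAt ctc = suc ctc , suc ctc + bestLen ctc

  IsBlock : ℕ × ℕ → Set
  IsBlock I = ∃ λ ctc → ctc < n × I ≡ blockAt ctc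

  private
    parseFuel-blocks : ∀ fuel ctc → All IsBlock (intervalsFrom (suc ctc) (parseFuel fuel ctc))
    parseFuel-blocks zero       ctc = []
    parseFuel-blocks (suc fuel) ctc with ctc <ᵇ n in ctc<ᵇn
    ... | false = []
    ... | true  = (ctc , <ᵇ⇒< ctc n (Equivalence.from T-≡ ctc<ᵇn) , refl) ∷ parseFuel-blocks fuel (ctc + suc (bestLen ctc))

  compress-blocks : All IsBlock (intervals compress)
  compress-blocks = parseFuel-blocks n 0

-- Two words that differ in one position

module OneMismatch {A : Set} (_≟ᴬ_ : DecidableEquality A) (w w' : List A) (same-length : length w' ≡ length w)
                   (J : ℕ) (agree : ∀ x → x ≢ J → charAt w x ≡ charAt w' x) where

  open Greedy _≟ᴬ_ w
  module G′ = Greedy _≟ᴬ_ w'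

  Avoids : ℕ × ℕ → Set
  Avoids I = ¬ (proj₁ I ≤ J × J ≤ proj₂ I)

  -- the block of w' at c + d ends before the last character of the block of w at c
  HasInnerBlock : ℕ → Set
  HasInnerBlock c = ∃ λ d → d + G′.bestLen (c + d) < bestLen c

  inner-from-block : ∀ {c I'} → G′.IsBlock I' → suc c ≤ proj₁ I' × proj₂ I' < suc c + bestLen c → HasInnerBlock c
  inner-from-block {c} (c' , _ , refl) (1+c≤1+c' , f'<f) = c' ∸ c , +-cancelˡ-< c _ _ (begin-strict
    c + (c' ∸ c + G′.bestLen (c + (c' ∸ c))) ≡⟨ sym (+-assoc c (c' ∸ c) _) ⟩
    c + (c' ∸ c) + G′.bestLen (c + (c' ∸ c)) ≡⟨ cong (λ k → k + G′.bestLen k) (m+[n∸m]≡n (s≤s⁻¹ 1+c≤1+c')) ⟩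
    c' + G′.bestLen c'                       <⟨ s≤s⁻¹ f'<f ⟩
    c + bestLen c                            ∎)
    where open ≤-Reasoning

  two-starts⇒inner : ∀ {c} → startsInside G′.compress (blockAt c) ≡ 2 → HasInnerBlock c
  two-starts⇒inner {c} two = All.lookupWith inner-from-block G′.compress-blocks
    (inner-of-two-starts 1 G′.compress (≤-reflexive (sym two)))

  Copy : ℕ → ℕ → Set
  Copy c r = ∀ x → x < bestLen c → charAt w (suc (c + x)) ≡ charAt w' (r + x)

  inner⇒0<bestLen : ∀ {c} → HasInnerBlock c → 0 < bestLen c
  inner⇒0<bestLen (_ , d+ℓ'<ℓ) = ≤-<-trans z≤n d+ℓ'<ℓ

  agree-in-block : ∀ {c x} → Avoids (blockAt c) → x < bestLen c → charAt w (suc (c + x)) ≡ charAt w' (suc (c + x))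
  agree-in-block {c} {x} avoids x<ℓ = agree (suc (c + x)) λ { refl → avoids (s≤s (m≤m+n c x) , s≤s (+-monoʳ-≤ c (<⇒≤ x<ℓ))) }

  -- Copying from r + d, the block of w' at c + d could have been one character longer.
  inner-block-not-copied : ∀ {c r} → c < n → Avoids (blockAt c) → HasInnerBlock c → 1 ≤ r → r ≤ c → Copy c r → ⊥
  inner-block-not-copied {c} {r} c<n avoids (d , d+ℓ'<ℓ) 1≤r r≤c copy =
    n≮n ℓ' (G′.bestLen-maximal extension-fits (≤-trans 1≤r (m≤m+n r d) , +-monoˡ-≤ d r≤c , extension-matches))
    where
      ℓ' = G′.bestLen (c + d)
      extension-fits : c + d + suc ℓ' < G′.n
      extension-fits = begin-strict
        c + d + suc ℓ'   ≡⟨ trans (+-assoc c d (suc ℓ')) (cong (c +_) (+-suc d ℓ')) ⟩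
        c + suc (d + ℓ') ≤⟨ +-monoʳ-≤ c d+ℓ'<ℓ ⟩
        c + bestLen c    <⟨ bestLen-bounded c<n ⟩
        n                ≡⟨ sym same-length ⟩
        G′.n             ∎
        where open ≤-Reasoning
      extension-matches : G′.Match (c + d) (r + d) (suc ℓ')
      extension-matches e e≤ℓ' = begin
        charAt w' (suc (c + d + e))   ≡⟨ cong (charAt w' ∘ suc) (+-assoc c d e) ⟩
        charAt w' (suc (c + (d + e))) ≡⟨ sym (agree-in-block avoids d+e<ℓ) ⟩
        charAt w (suc (c + (d + e)))  ≡⟨ copy (d + e) d+e<ℓ ⟩
        charAt w' (r + (d + e))       ≡⟨ cong (charAt w') (sym (+-assoc r d e)) ⟩
        charAt w' (r + d + e)         ∎
        where
          open ≡-Reasoning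
          d+e<ℓ : d + e < bestLen c
          d+e<ℓ = ≤-<-trans (+-monoʳ-≤ d (s≤s⁻¹ e≤ℓ')) d+ℓ'<ℓ

  window-avoiding-J⇒⊥ : ∀ {c} → c < n → Avoids (blockAt c) → HasInnerBlock c →
                       J < bestSrc c ⊎ bestSrc c + bestLen c ≤ J → ⊥
  window-avoiding-J⇒⊥ {c} c<n avoids inner J∉ with bestSrc-source (inner⇒0<bestLen inner)
  ... | 1≤q , q≤c , match = inner-block-not-copied c<n avoids inner 1≤q q≤c copy
    where
      q = bestSrc c
      copy : Copy c q
      copy x x<ℓ = trans (match x x<ℓ) (agree (q + x) q+x≢J)
        where
          q+x≢J : q + x ≢ J
          q+x≢J refl = [ (λ q+x<q → <⇒≱ q+x<q (m≤m+n q x))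
                       , (λ q+ℓ≤q+x → <⇒≱ x<ℓ (+-cancelˡ-≤ q _ _ q+ℓ≤q+x)) ]′ J∉

  source-straddles : ∀ {c} → c < n → Avoids (blockAt c) → HasInnerBlock c → bestSrc c ≤ J × J < bestSrc c + bestLen c
  source-straddles {c} c<n avoids inner with bestSrc c ≤? J | J <? bestSrc c + bestLen c
  ... | yes q≤J | yes J<q+ℓ = q≤J , J<q+ℓ
  ... | no q≰J  | _         = ⊥-elim (window-avoiding-J⇒⊥ c<n avoids inner (inj₁ (≰⇒> q≰J)))
  ... | yes _   | no J≮q+ℓ  = ⊥-elim (window-avoiding-J⇒⊥ c<n avoids inner (inj₂ (≮⇒≥ J≮q+ℓ)))

  repeated-source : ∀ {c₁ c₂} → c₂ < n → Avoids (blockAt c₁) → Avoids (blockAt c₂) → HasInnerBlock c₂ →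
                    Precedes (blockAt c₁) (blockAt c₂) → bestLen c₁ ≡ bestLen c₂ → bestSrc c₁ ≢ bestSrc c₂
  repeated-source {c₁} {c₂} c₂<n avoids₁ avoids₂ inner c₁≺c₂ ℓ₁≡ℓ₂ q₁≡q₂ =
    inner-block-not-copied c₂<n avoids₂ inner (s≤s z≤n) (≤-trans (s≤s (m≤m+n c₁ _)) (s≤s⁻¹ c₁≺c₂)) copy
    where
      copy : Copy c₂ (suc c₁)
      copy x x<ℓ₂ = begin
        charAt w (suc (c₂ + x))   ≡⟨ proj₂ (proj₂ (bestSrc-source (inner⇒0<bestLen inner))) x x<ℓ₂ ⟩
        charAt w (bestSrc c₂ + x) ≡⟨ cong (λ q → charAt w (q + x)) (sym q₁≡q₂) ⟩
        charAt w (bestSrc c₁ + x) ≡⟨ sym (proj₂ (proj₂ (bestSrc-source 0<ℓ₁)) x x<ℓ₁) ⟩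
        charAt w (suc (c₁ + x))   ≡⟨ agree-in-block avoids₁ x<ℓ₁ ⟩
        charAt w' (suc c₁ + x)    ∎
        where
          open ≡-Reasoning
          x<ℓ₁ = subst (x <_) (sym ℓ₁≡ℓ₂) x<ℓ₂
          0<ℓ₁ = subst (0 <_) (sym ℓ₁≡ℓ₂) (inner⇒0<bestLen inner)

  Candidate : ℕ × ℕ → Set
  Candidate I = ∃ λ c → I ≡ blockAt c × c < n × HasInnerBlock c × Avoids I

  tag : ℕ × ℕ → ℕ × ℕ
  tag I = proj₂ I ∸ proj₁ I , J ∸ bestSrc (pred (proj₁ I))

  tag-blockAt : ∀ c → proj₁ (tag (blockAt c)) ≡ bestLen c
  tag-blockAt c = m+n∸m≡n (suc c) (bestLen c)

  tag-snd<fst : ∀ {I} → Candidate I → proj₂ (tag I) < proj₁ (tag I)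
  tag-snd<fst (c , refl , c<n , inner , avoids) with source-straddles c<n avoids inner
  ... | q≤J , J<q+ℓ rewrite tag-blockAt c = subst (J ∸ bestSrc c <_) (m+n∸m≡n (bestSrc c) (bestLen c)) (∸-monoˡ-< J<q+ℓ q≤J)

  tag-injective : ∀ {I₁ I₂} → Candidate I₁ → Candidate I₂ → Precedes I₁ I₂ → tag I₁ ≢ tag I₂
  tag-injective (c₁ , refl , c₁<n , inner₁ , avoids₁) (c₂ , refl , c₂<n , inner₂ , avoids₂) c₁≺c₂ same-tag =
    repeated-source c₂<n avoids₁ avoids₂ inner₂ c₁≺c₂ ℓ₁≡ℓ₂
      (∸-cancelˡ-≡ (proj₁ (source-straddles c₁<n avoids₁ inner₁)) (proj₁ (source-straddles c₂<n avoids₂ inner₂))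
                   (cong proj₂ same-tag))
    where
      ℓ₁≡ℓ₂ : bestLen c₁ ≡ bestLen c₂
      ℓ₁≡ℓ₂ = trans (sym (tag-blockAt c₁)) (trans (cong proj₁ same-tag) (tag-blockAt c₂))

  doubled : List (ℕ × ℕ)
  doubled = filter (λ I → startsInside G′.compress I ≟ 2) (intervals compress)

  contains? : (I : ℕ × ℕ) → Dec (proj₁ I ≤ J × J ≤ proj₂ I)
  contains? I = between? (proj₁ I) (proj₂ I) J

  doubled-avoiding : List (ℕ × ℕ)
  doubled-avoiding = filter (¬? ∘ contains?) doubled

  doubled-sorted : AllPairs Precedes doubled
  doubled-sorted = AllPairs.filter⁺ _ (intervalsFrom-sorted 1 compress)

  doubled-avoiding-sorted : AllPairs Precedes doubled-avoiding
  doubled-avoiding-sorted = AllPairs.filter⁺ (¬? ∘ contains?) doubled-sorted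

  length-doubled≤ : length doubled ≤ suc (length doubled-avoiding)
  length-doubled≤ = length≤1+length-filter-¬ contains? (AllPairs.map not-both doubled-sorted)
    where
      not-both : ∀ {I I'} → Precedes I I' → ¬ ((proj₁ I ≤ J × J ≤ proj₂ I) × (proj₁ I' ≤ J × J ≤ proj₂ I'))
      not-both f<s' ((_ , J≤f) , (s'≤J , _)) = <⇒≱ (≤-<-trans J≤f f<s') s'≤J

  doubled-avoiding-candidates : All Candidate doubled-avoiding
  doubled-avoiding-candidates =
    All.zipWith (λ { (((c , c<n , refl) , two) , avoids) → c , refl , c<n , two-starts⇒inner two , avoids })
      (All.filter⁺ (¬? ∘ contains?) (All.zipWith id (All.filter⁺ _ compress-blocks , All.all-filter _ (intervals compress)))
      , All.all-filter (¬? ∘ contains?) doubled)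

  tags : List (ℕ × ℕ)
  tags = map tag doubled-avoiding

  tags-unique : Unique tags
  tags-unique = AllPairs.map⁺ (AllPairs-mapWithAll doubled-avoiding-candidates doubled-avoiding-sorted tag-injective)

  tags-snd<fst : All (λ t → proj₂ t < proj₁ t) tags
  tags-snd<fst = All.map⁺ (All.map tag-snd<fst doubled-avoiding-candidates)

  tags-weight≤ : sum (map (suc ∘ proj₁) tags) ≤ n
  tags-weight≤ = s≤s⁻¹ (begin
    suc (sum (map (suc ∘ proj₁) tags))  ≡⟨ cong (suc ∘ sum) (sym (map-∘ doubled-avoiding)) ⟩
    1 + sum (map width doubled-avoiding)
      ≤⟨ sum-width≤ doubled-avoiding doubled-avoiding-sorted (All.map bounds doubled-avoiding-candidates) (s≤s z≤n) ⟩
    suc n                                ∎)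
    where
      open ≤-Reasoning
      bounds : ∀ {I} → Candidate I → 1 ≤ proj₁ I × proj₁ I ≤ proj₂ I × proj₂ I < suc n
      bounds (c , refl , c<n , _) = s≤s z≤n , m≤m+n (suc c) (bestLen c) , s≤s (bestLen-bounded c<n)

  t₂-bound : ∀ p r .{{_ : NonZero r}} → 3 * n * r ^ 3 ≤ p ^ 3 →
             2 * t₂ compress G′.compress * r ^ 2 ≤ 2 * r ^ 2 + p ^ 2 + p * r
  t₂-bound p r 3nr³≤p³ = begin
    2 * length doubled * r ^ 2                   ≤⟨ *-monoˡ-≤ (r ^ 2) (*-monoʳ-≤ 2 length-doubled≤) ⟩
    2 * suc (length doubled-avoiding) * r ^ 2    ≡⟨ split (length doubled-avoiding) (r ^ 2) ⟩
    2 * r ^ 2 + 2 * length doubled-avoiding * r ^ 2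
      ≡⟨ cong (λ k → 2 * r ^ 2 + 2 * k * r ^ 2) (sym (length-map tag doubled-avoiding)) ⟩
    2 * r ^ 2 + 2 * length tags * r ^ 2
      ≤⟨ +-monoʳ-≤ (2 * r ^ 2) (distinct-pairs-length≤ tags-unique tags-snd<fst n p r tags-weight≤ 3nr³≤p³) ⟩
    2 * r ^ 2 + (p ^ 2 + p * r)                  ≡⟨ sym (+-assoc (2 * r ^ 2) (p ^ 2) (p * r)) ⟩
    2 * r ^ 2 + p ^ 2 + p * r                    ∎
    where
      open ≤-Reasoning
      split : ∀ a b → 2 * suc a * b ≡ 2 * b + 2 * a * b
      split = solve-∀

charAt-toList-agree : {A : Set} {n : ℕ} (v v' : Vec A n) (i : Fin n) → (∀ j → j ≢ i → lookup v j ≡ lookup v' j) →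
                      ∀ x → x ≢ suc (toℕ i) → charAt (toList v) x ≡ charAt (toList v') x
charAt-toList-agree (a ∷ v) (a' ∷ v') i        agree zero          _   = refl
charAt-toList-agree (a ∷ v) (a' ∷ v') fzero    agree (suc zero)    x≢1 = contradiction refl x≢1
charAt-toList-agree (a ∷ v) (a' ∷ v') (fsuc i) agree (suc zero)    _   = cong just (agree fzero λ ())
charAt-toList-agree (a ∷ v) (a' ∷ v') fzero    agree (suc (suc x)) _   = cong (λ u → charAt (toList u) (suc x)) v≡v'
  where
    v≡v' = trans (sym (tabulate∘lookup v)) (trans (tabulate-cong (λ j → agree (fsuc j) λ ())) (tabulate∘lookup v'))
charAt-toList-agree (a ∷ v) (a' ∷ v') (fsuc i) agree (suc (suc x)) x≢  =
  charAt-toList-agree v v' i (λ j j≢i → agree (fsuc j) (j≢i ∘ fsuc-injective)) (suc x) (x≢ ∘ cong suc)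

lemma4 : {A : Set} (_≟_ : DecidableEquality A) (n : ℕ) (w w' : Vec A n) →
         DifferInExactlyOne w w' →
         (p q : ℕ) → 1 ≤ q → 3 * n * q ^ 3 ≤ p ^ 3 →
         2 * t₂ (compressSR _≟_ (toList w)) (compressSR _≟_ (toList w')) * q ^ 2
           ≤ 2 * q ^ 2 + p ^ 2 + p * q
lemma4 _≟_ n w w' (i , _ , agree) p q 0<q 3nq³≤p³ =
  OneMismatch.t₂-bound _≟_ (toList w) (toList w') (trans (length-toList w') (sym (length-toList w)))
    (suc (toℕ i)) (charAt-toList-agree w w' i agree) p q {{>-nonZero 0<q}}
    (subst (λ k → 3 * k * q ^ 3 ≤ p ^ 3) (sym (length-toList w)) 3nq³≤p³)
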